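{- For any integers $m,n\ge 0$, $$\frac{1}{n!}D_{m+n}=\sum_{l=0}^{n}\sum_{k=0}^{m}\binom{k+n-l-1}{n-l}\binom{m}{k}(-1)^{m-k}\frac{k!}{l!}D_l,$$ where $D_j$ denotes the $j$-th derangement number.
   Context: For a nonnegative integer $j$, the derangement number is $D_j=j!\sum_{i=0}^{j}\frac{(-1)^i}{i!}$ (the number of permutations of a $j$-element set with no fixed points), so that $\frac{e^{ -t}}{1-t}=\sum_{j\ge0}D_j\frac{t^j}{j!}$. Binomial coefficients are the generalized ones: for any real (or integer, possibly negative) $x$ and integer $j\ge 0$, $\binom{x}{j}=\frac{x(x-1)\cdots(x-j+1)}{j!}$, with $\binom{x}{0}=1$; in particular $\binom{ -1}{0}=1$ and $\binom{j-1}{j}=0$ for $j\ge1$. -}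

module Defs where

open import Data.Nat as ℕ using (ℕ; zero; suc; _!)
open import Data.Nat.Properties using (_!≢0)
open import Data.Integer as ℤ using (ℤ; +_)
open import Data.Rational as ℚ using (ℚ; _/_)

sumTo : ℕ → (ℕ → ℚ) → ℚ
sumTo zero    f = f 0
sumTo (suc n) f = sumTo n f ℚ.+ f (suc n)

sgn : ℕ → ℚ
sgn zero    = ℚ.1ℚ
sgn (suc i) = ℚ.- sgn i

ι : ℕ → ℚ
ι n = (+ n) / 1

inv! : ℕ → ℚ
inv! j = (+ 1) / (j !)
  where instance _ = j !≢0

falling : ℤ → ℕ → ℤ
falling x zero    = + 1
falling x (suc j) = falling x j ℤ.* (x ℤ.- (+ j))

binom : ℤ → ℕ → ℚ
binom x j = falling x j / (j !)
  where instance _ = j !≢0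

D : ℕ → ℚ
D j = ι (j !) ℚ.* sumTo j (λ i → sgn i ℚ.* inv! i)

-- Read a sequence f as the power series Σ f n tⁿ: partialSums multiplies by 1/(1-t), ⋆ is the
-- Cauchy product and derivative is d/dt.  With E n = D n / n!, the series of E is e^{-t}/(1-t) and
-- that of partialSums^ k E is e^{-t}/(1-t)^{k+1}, whose coefficients are multichoose k ⋆ E.
-- The left-hand side D (m + n) / n! is the n-th coefficient of the m-th derivative of e^{-t}/(1-t),
-- and the Leibniz rule writes that derivative as Σₖ C(m,k) (-1)^{m-k} k! e^{-t}/(1-t)^{k+1}.
-- Without power series this becomes an induction on m: both sides satisfy aₘ₊₁(n) = (n+1) aₘ(n+1),
-- the right-hand side because d/dt + 1 maps e^{-t}/(1-t)^{k+1} to (k+1) e^{-t}/(1-t)^{k+2}.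

module Submission where

open import Data.Nat as ℕ using (ℕ; zero; suc; _!; _∸_; NonZero; _≤_; _<_; _≤′_; ≤′-refl; ≤′-step)
import Data.Nat.Properties as ℕ
open import Data.Integer as ℤ using (+_)
import Data.Integer.Properties as ℤ
open import Data.Integer.Tactic.RingSolver using () renaming (solve-∀ to ℤ-solve-∀)
open import Data.Rational as ℚ using (ℚ; 0ℚ; 1ℚ; _/_; _+_; _*_; -_; _-_; toℚᵘ)
open import Data.Rational.Properties
  using (+-*-commutativeRing; _≟_; toℚᵘ-injective; toℚᵘ-fromℚᵘ; toℚᵘ-homo-+; toℚᵘ-homo-*;
         fromℚᵘ-cong; 0/n≡0;
         +-assoc; +-comm; *-assoc; *-zeroˡ; *-identityˡ; *-distribʳ-+; +-identityˡ; +-identityʳ)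
open import Data.Rational.Unnormalised as ℚᵘ using (mkℚᵘ; *≡*)
import Data.Rational.Unnormalised.Properties as ℚᵘ
open import Level using (0ℓ)
open import Relation.Nullary.Decidable using (yes; no; dec⇒maybe)
open import Relation.Binary.PropositionalEquality
open import Tactic.RingSolver using (solve-∀)
open import Tactic.RingSolver.Core.AlmostCommutativeRing using (AlmostCommutativeRing; fromCommutativeRing)

open import Defs

ℚ-ring : AlmostCommutativeRing 0ℓ 0ℓ
ℚ-ring = fromCommutativeRing +-*-commutativeRing (λ p → dec⇒maybe (0ℚ ≟ p))

sumTo-cong : ∀ n {f g : ℕ → ℚ} → (∀ i → f i ≡ g i) → sumTo n f ≡ sumTo n g
sumTo-cong zero    f≗g = f≗g 0
sumTo-cong (suc n) f≗g = cong₂ _+_ (sumTo-cong n f≗g) (f≗g (suc n))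

sumTo-cong-≤ : ∀ n {f g : ℕ → ℚ} → (∀ i → i ≤ n → f i ≡ g i) → sumTo n f ≡ sumTo n g
sumTo-cong-≤ zero    f≗g = f≗g 0 ℕ.z≤n
sumTo-cong-≤ (suc n) f≗g =
  cong₂ _+_ (sumTo-cong-≤ n (λ i i≤n → f≗g i (ℕ.m≤n⇒m≤1+n i≤n))) (f≗g (suc n) ℕ.≤-refl)

sumTo-distrib-+ : ∀ n (f g : ℕ → ℚ) → sumTo n (λ i → f i + g i) ≡ sumTo n f + sumTo n g
sumTo-distrib-+ zero    f g = refl
sumTo-distrib-+ (suc n) f g =
  trans (cong (_+ (f (suc n) + g (suc n))) (sumTo-distrib-+ n f g))
        (interchange (sumTo n f) (sumTo n g) (f (suc n)) (g (suc n)))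
  where
  interchange : ∀ a b c d → (a + b) + (c + d) ≡ (a + c) + (b + d)
  interchange = solve-∀ ℚ-ring

*-distribˡ-sumTo : ∀ n a (f : ℕ → ℚ) → a * sumTo n f ≡ sumTo n (λ i → a * f i)
*-distribˡ-sumTo zero    a f = refl
*-distribˡ-sumTo (suc n) a f =
  trans (distrib a (sumTo n f) (f (suc n))) (cong (_+ (a * f (suc n))) (*-distribˡ-sumTo n a f))
  where
  distrib : ∀ a x y → a * (x + y) ≡ a * x + a * y
  distrib = solve-∀ ℚ-ring

sumTo-distrib-minus : ∀ n (f g : ℕ → ℚ) → sumTo n (λ i → f i - g i) ≡ sumTo n f - sumTo n g
sumTo-distrib-minus zero    f g = refl
sumTo-distrib-minus (suc n) f g =
  trans (cong (_+ (f (suc n) - g (suc n))) (sumTo-distrib-minus n f g))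
        (interchange (sumTo n f) (sumTo n g) (f (suc n)) (g (suc n)))
  where
  interchange : ∀ a b c d → (a - b) + (c - d) ≡ (a + c) - (b + d)
  interchange = solve-∀ ℚ-ring

sumTo-zero : ∀ n → sumTo n (λ _ → 0ℚ) ≡ 0ℚ
sumTo-zero zero    = refl
sumTo-zero (suc n) = cong (_+ 0ℚ) (sumTo-zero n)

sumTo-comm : ∀ m n (f : ℕ → ℕ → ℚ) →
             sumTo m (λ i → sumTo n (f i)) ≡ sumTo n (λ j → sumTo m (λ i → f i j))
sumTo-comm zero    n f = refl
sumTo-comm (suc m) n f =
  trans (cong (_+ sumTo n (f (suc m))) (sumTo-comm m n f))
        (sym (sumTo-distrib-+ n (λ j → sumTo m (λ i → f i j)) (f (suc m))))

sumTo-suc-head : ∀ n (f : ℕ → ℚ) → sumTo (suc n) f ≡ f 0 + sumTo n (λ i → f (suc i))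
sumTo-suc-head zero    f = refl
sumTo-suc-head (suc n) f =
  trans (cong (_+ f (suc (suc n))) (sumTo-suc-head n f))
        (+-assoc (f 0) (sumTo n (λ i → f (suc i))) (f (suc (suc n))))

/-distrib-+ : ∀ i j n .{{_ : NonZero n}} → (i ℤ.+ j) / n ≡ i / n + j / n
/-distrib-+ i j (suc d) = toℚᵘ-injective (begin-equality
  toℚᵘ ((i ℤ.+ j) / suc d)               ≃⟨ toℚᵘ-fromℚᵘ (mkℚᵘ (i ℤ.+ j) d) ⟩
  mkℚᵘ (i ℤ.+ j) d                       ≃⟨ *≡* (cross i j (+ suc d)) ⟩
  mkℚᵘ i d ℚᵘ.+ mkℚᵘ j d
    ≃⟨ ℚᵘ.+-cong (toℚᵘ-fromℚᵘ (mkℚᵘ i d)) (toℚᵘ-fromℚᵘ (mkℚᵘ j d)) ⟨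
  toℚᵘ (i / suc d) ℚᵘ.+ toℚᵘ (j / suc d) ≃⟨ toℚᵘ-homo-+ (i / suc d) (j / suc d) ⟨
  toℚᵘ (i / suc d + j / suc d)           ∎)
  where
  open ℚᵘ.≤-Reasoning
  cross : ∀ i j n → (i ℤ.+ j) ℤ.* (n ℤ.* n) ≡ (i ℤ.* n ℤ.+ j ℤ.* n) ℤ.* n
  cross = ℤ-solve-∀

/1-*-/ : ∀ k i n .{{_ : NonZero n}} → (k / 1) * (i / n) ≡ (k ℤ.* i) / n
/1-*-/ k i (suc d) = toℚᵘ-injective (begin-equality
  toℚᵘ (k / 1 * (i / suc d))           ≃⟨ toℚᵘ-homo-* (k / 1) (i / suc d) ⟩
  toℚᵘ (k / 1) ℚᵘ.* toℚᵘ (i / suc d)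
    ≃⟨ ℚᵘ.*-cong (toℚᵘ-fromℚᵘ (mkℚᵘ k 0)) (toℚᵘ-fromℚᵘ (mkℚᵘ i d)) ⟩
  mkℚᵘ k 0 ℚᵘ.* mkℚᵘ i d               ≃⟨ *≡* (cross k i (+ suc d)) ⟩
  mkℚᵘ (k ℤ.* i) d                     ≃⟨ toℚᵘ-fromℚᵘ (mkℚᵘ (k ℤ.* i) d) ⟨
  toℚᵘ ((k ℤ.* i) / suc d)             ∎)
  where
  open ℚᵘ.≤-Reasoning
  cross : ∀ k i n → (k ℤ.* i) ℤ.* n ≡ (k ℤ.* i) ℤ.* (+ 1 ℤ.* n)
  cross = ℤ-solve-∀

/-cancelˡ : ∀ m i n .{{_ : NonZero m}} .{{_ : NonZero n}} .{{_ : NonZero (m ℕ.* n)}} →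
            (+ m ℤ.* i) / (m ℕ.* n) ≡ i / n
/-cancelˡ (suc a) i (suc d) =
  fromℚᵘ-cong {mkℚᵘ (+ suc a ℤ.* i) (d ℕ.+ a ℕ.* suc d)} {mkℚᵘ i d} (*≡* (cross (+ suc a) i (+ suc d)))
  where
  cross : ∀ m i n → (m ℤ.* i) ℤ.* n ≡ i ℤ.* (m ℤ.* n)
  cross = ℤ-solve-∀

ι-suc : ∀ n → ι (suc n) ≡ 1ℚ + ι n
ι-suc n = /-distrib-+ (+ 1) (+ n) 1

ι-* : ∀ m n → ι (m ℕ.* n) ≡ ι m * ι n
ι-* m n = trans (cong (_/ 1) (ℤ.pos-* m n)) (sym (/1-*-/ (+ m) (+ n) 1))

ι-suc-*-inv!-suc : ∀ n → ι (suc n) * inv! (suc n) ≡ inv! n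
ι-suc-*-inv!-suc n = trans (/1-*-/ (+ suc n) (+ 1) (suc n !) {{suc n ℕ.!≢0}})
                           (/-cancelˡ (suc n) (+ 1) (n !) {{_}} {{n ℕ.!≢0}} {{suc n ℕ.!≢0}})

inv!-*-ι! : ∀ n → inv! n * ι (n !) ≡ 1ℚ
inv!-*-ι! zero    = refl
inv!-*-ι! (suc n) = begin
  inv! (suc n) * ι (suc n ℕ.* n !)        ≡⟨ cong (inv! (suc n) *_) (ι-* (suc n) (n !)) ⟩
  inv! (suc n) * (ι (suc n) * ι (n !))    ≡⟨ reassoc (inv! (suc n)) (ι (suc n)) (ι (n !)) ⟩
  (ι (suc n) * inv! (suc n)) * ι (n !)    ≡⟨ cong (_* ι (n !)) (ι-suc-*-inv!-suc n) ⟩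
  inv! n * ι (n !)                        ≡⟨ inv!-*-ι! n ⟩
  1ℚ                                      ∎
  where
  open ≡-Reasoning
  reassoc : ∀ a b c → a * (b * c) ≡ (b * a) * c
  reassoc = solve-∀ ℚ-ring

falling-suc : ∀ x j → falling x (suc j) ≡ x ℤ.* falling (x ℤ.- + 1) j
falling-suc x zero    = unit x
  where
  unit : ∀ x → + 1 ℤ.* (x ℤ.- + 0) ≡ x ℤ.* + 1
  unit = ℤ-solve-∀
falling-suc x (suc j) = begin
  falling x (suc j) ℤ.* (x ℤ.- + suc j)                 ≡⟨ cong (ℤ._* (x ℤ.- + suc j)) (falling-suc x j) ⟩
  x ℤ.* falling (x ℤ.- + 1) j ℤ.* (x ℤ.- + suc j)       ≡⟨ shift x (falling (x ℤ.- + 1) j) (+ j) ⟩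
  x ℤ.* (falling (x ℤ.- + 1) j ℤ.* (x ℤ.- + 1 ℤ.- + j)) ∎
  where
  open ≡-Reasoning
  shift : ∀ x F j → x ℤ.* F ℤ.* (x ℤ.- (+ 1 ℤ.+ j)) ≡ x ℤ.* (F ℤ.* (x ℤ.- + 1 ℤ.- j))
  shift = ℤ-solve-∀

falling-pascal : ∀ x j →
                 falling x (suc j) ≡ falling (x ℤ.- + 1) (suc j) ℤ.+ + suc j ℤ.* falling (x ℤ.- + 1) j
falling-pascal x j = trans (falling-suc x j) (split x (falling (x ℤ.- + 1) j) (+ j))
  where
  split : ∀ x F j → x ℤ.* F ≡ F ℤ.* (x ℤ.- + 1 ℤ.- j) ℤ.+ (+ 1 ℤ.+ j) ℤ.* F
  split = ℤ-solve-∀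

binom-pascal : ∀ x j → binom x (suc j) ≡ binom (x ℤ.- + 1) (suc j) + binom (x ℤ.- + 1) j
binom-pascal x j = begin
  falling x (suc j) / (suc j !)                          ≡⟨ cong (_/ (suc j !)) (falling-pascal x j) ⟩
  (F₁ ℤ.+ + suc j ℤ.* F₀) / (suc j !)                    ≡⟨ /-distrib-+ F₁ (+ suc j ℤ.* F₀) (suc j !) ⟩
  F₁ / (suc j !) + (+ suc j ℤ.* F₀) / (suc j ℕ.* j !)
    ≡⟨ cong (_+_ (F₁ / (suc j !))) (/-cancelˡ (suc j) F₀ (j !)) ⟩
  F₁ / (suc j !) + F₀ / (j !)                            ∎
  where
  open ≡-Reasoning
  instance
    _ = j ℕ.!≢0
    _ = suc j ℕ.!≢0
  F₁ = falling (x ℤ.- + 1) (suc j)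
  F₀ = falling (x ℤ.- + 1) j

falling-vanishes : ∀ {m k} → m ≤′ k → falling (+ m) (suc k) ≡ + 0
falling-vanishes {m} ≤′-refl    =
  trans (cong (falling (+ m) m ℤ.*_) (ℤ.+-inverseʳ (+ m))) (ℤ.*-zeroʳ (falling (+ m) m))
falling-vanishes {m} {suc k} (≤′-step m≤′k) = cong (ℤ._* (+ m ℤ.- + suc k)) (falling-vanishes m≤′k)

binom-vanishes : ∀ {m k} → m ≤ k → binom (+ m) (suc k) ≡ 0ℚ
binom-vanishes {k = k} m≤k = begin
  falling (+ _) (suc k) / (suc k !) ≡⟨ cong (_/ (suc k !)) (falling-vanishes (ℕ.≤⇒≤′ m≤k)) ⟩
  + 0 / (suc k !)                   ≡⟨ 0/n≡0 (suc k !) ⟩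
  0ℚ                                ∎
  where
  open ≡-Reasoning
  instance _ = suc k ℕ.!≢0

sgn-∸-suc : ∀ {m k} → k < m → sgn (m ∸ k) ≡ - sgn (m ∸ suc k)
sgn-∸-suc {suc m} {zero}  _           = refl
sgn-∸-suc {suc m} {suc k} (ℕ.s≤s k<m) = sgn-∸-suc k<m

partialSums : (ℕ → ℚ) → ℕ → ℚ
partialSums f n = sumTo n f

_⋆_ : (ℕ → ℚ) → (ℕ → ℚ) → ℕ → ℚ
(f ⋆ g) n = sumTo n (λ l → f (n ∸ l) * g l)

⋆-congˡ : ∀ {f f′} g n → (∀ j → f j ≡ f′ j) → (f ⋆ g) n ≡ (f′ ⋆ g) n
⋆-congˡ g n f≗f′ = sumTo-cong n (λ l → cong (_* g l) (f≗f′ (n ∸ l)))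

⋆-identityˡ : ∀ f g → f 0 ≡ 1ℚ → (∀ j → f (suc j) ≡ 0ℚ) → ∀ n → (f ⋆ g) n ≡ g n
⋆-identityˡ f g f0≡1 _        zero    = trans (cong (_* g 0) f0≡1) (*-identityˡ (g 0))
⋆-identityˡ f g f0≡1 fsuc≡0 (suc n) = begin
  sumTo n (λ l → f (suc n ∸ l) * g l) + f (suc n ∸ suc n) * g (suc n)
    ≡⟨ cong₂ _+_ (trans (sumTo-cong-≤ n vanish) (sumTo-zero n))
                 (cong (λ j → f j * g (suc n)) (ℕ.n∸n≡0 n)) ⟩
  0ℚ + f 0 * g (suc n)
    ≡⟨ trans (+-identityˡ _) (cong (_* g (suc n)) f0≡1) ⟩
  1ℚ * g (suc n)
    ≡⟨ *-identityˡ (g (suc n)) ⟩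
  g (suc n) ∎
  where
  open ≡-Reasoning
  vanish : ∀ l → l ≤ n → f (suc n ∸ l) * g l ≡ 0ℚ
  vanish l l≤n = trans (cong (λ j → f j * g l) (ℕ.+-∸-assoc 1 l≤n))
                       (trans (cong (_* g l) (fsuc≡0 (n ∸ l))) (*-zeroˡ (g l)))

⋆-partialSumsˡ : ∀ f g n → (partialSums f ⋆ g) n ≡ partialSums (f ⋆ g) n
⋆-partialSumsˡ f g zero    = refl
⋆-partialSumsˡ f g (suc n) = begin
  sumTo n (λ l → partialSums f (suc n ∸ l) * g l) + partialSums f (suc n ∸ suc n) * g (suc n)
    ≡⟨ cong₂ _+_ (trans (sumTo-cong-≤ n split) (sumTo-distrib-+ n _ _))
                 (cong (_* g (suc n)) last) ⟩
  ((partialSums f ⋆ g) n + sumTo n (λ l → f (suc n ∸ l) * g l)) + f (n ∸ n) * g (suc n)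
    ≡⟨ +-assoc ((partialSums f ⋆ g) n) _ _ ⟩
  (partialSums f ⋆ g) n + (f ⋆ g) (suc n)
    ≡⟨ cong (_+ (f ⋆ g) (suc n)) (⋆-partialSumsˡ f g n) ⟩
  partialSums (f ⋆ g) (suc n) ∎
  where
  open ≡-Reasoning
  split : ∀ l → l ≤ n → partialSums f (suc n ∸ l) * g l ≡ partialSums f (n ∸ l) * g l + f (suc n ∸ l) * g l
  split l l≤n rewrite ℕ.+-∸-assoc 1 l≤n = *-distribʳ-+ (g l) (partialSums f (n ∸ l)) (f (suc (n ∸ l)))
  last : partialSums f (n ∸ n) ≡ f (n ∸ n)
  last rewrite ℕ.n∸n≡0 n = refl

multichoose : ℕ → ℕ → ℚ
multichoose k j = binom (+ (k ℕ.+ j) ℤ.- + 1) j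

multichoose-zero-suc : ∀ j → multichoose 0 (suc j) ≡ 0ℚ
multichoose-zero-suc j = binom-vanishes {j} ℕ.≤-refl

multichoose-suc : ∀ k j → multichoose (suc k) j ≡ partialSums (multichoose k) j
multichoose-suc k zero    = refl
multichoose-suc k (suc j) = begin
  multichoose (suc k) (suc j)                          ≡⟨ binom-pascal (+ (k ℕ.+ suc j)) j ⟩
  multichoose k (suc j) + binom (+ (k ℕ.+ suc j) ℤ.- + 1) j
    ≡⟨ cong (λ i → multichoose k (suc j) + binom (+ i ℤ.- + 1) j) (ℕ.+-suc k j) ⟩
  multichoose k (suc j) + multichoose (suc k) j        ≡⟨ +-comm (multichoose k (suc j)) (multichoose (suc k) j) ⟩
  multichoose (suc k) j + multichoose k (suc j)        ≡⟨ cong (_+ multichoose k (suc j)) (multichoose-suc k j) ⟩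
  partialSums (multichoose k) (suc j)                  ∎
  where open ≡-Reasoning

partialSums^ : ℕ → (ℕ → ℚ) → ℕ → ℚ
partialSums^ zero    f = f
partialSums^ (suc k) f = partialSums (partialSums^ k f)

partialSums^-convolution : ∀ k g n → partialSums^ k g n ≡ (multichoose k ⋆ g) n
partialSums^-convolution zero    g n = sym (⋆-identityˡ (multichoose 0) g refl multichoose-zero-suc n)
partialSums^-convolution (suc k) g n = begin
  sumTo n (partialSums^ k g)                   ≡⟨ sumTo-cong n (partialSums^-convolution k g) ⟩
  partialSums (multichoose k ⋆ g) n            ≡⟨ ⋆-partialSumsˡ (multichoose k) g n ⟨
  (partialSums (multichoose k) ⋆ g) n          ≡⟨ ⋆-congˡ g n (λ j → sym (multichoose-suc k j)) ⟩
  (multichoose (suc k) ⋆ g) n                  ∎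
  where open ≡-Reasoning

derivative : (ℕ → ℚ) → ℕ → ℚ
derivative f n = ι (suc n) * f (suc n)

derivative-partialSums : ∀ f n → derivative (partialSums f) n
                                 ≡ partialSums (derivative f) n + partialSums (partialSums f) n
derivative-partialSums f zero    = base (f 0) (f 1)
  where
  base : ∀ a b → 1ℚ * (a + b) ≡ 1ℚ * b + a
  base = solve-∀ ℚ-ring
derivative-partialSums f (suc n) = begin
  ι (suc (suc n)) * (F + f (suc (suc n)))
    ≡⟨ cong (_* (F + f (suc (suc n)))) (ι-suc (suc n)) ⟩
  (1ℚ + ι (suc n)) * (F + f (suc (suc n)))
    ≡⟨ expand (ι (suc n)) F (f (suc (suc n))) ⟩
  (ι (suc n) * F + F) + (1ℚ + ι (suc n)) * f (suc (suc n))
    ≡⟨ cong₂ (λ x y → (x + F) + y * f (suc (suc n))) (derivative-partialSums f n) (sym (ι-suc (suc n))) ⟩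
  ((partialSums (derivative f) n + partialSums (partialSums f) n) + F) + derivative f (suc n)
    ≡⟨ regroup (partialSums (derivative f) n) (partialSums (partialSums f) n) F (derivative f (suc n)) ⟩
  partialSums (derivative f) (suc n) + partialSums (partialSums f) (suc n) ∎
  where
  open ≡-Reasoning
  F = partialSums f (suc n)
  expand : ∀ a F x → (1ℚ + a) * (F + x) ≡ (a * F + F) + (1ℚ + a) * x
  expand = solve-∀ ℚ-ring
  regroup : ∀ a b F x → ((a + b) + F) + x ≡ (a + x) + (b + F)
  regroup = solve-∀ ℚ-ring

E : ℕ → ℚ
E n = sumTo n (λ i → sgn i * inv! i)

inv!-*-D : ∀ n → inv! n * D n ≡ E n
inv!-*-D n = begin
  inv! n * (ι (n !) * E n)   ≡⟨ *-assoc (inv! n) (ι (n !)) (E n) ⟨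
  (inv! n * ι (n !)) * E n   ≡⟨ cong (_* E n) (inv!-*-ι! n) ⟩
  1ℚ * E n                   ≡⟨ *-identityˡ (E n) ⟩
  E n                        ∎
  where open ≡-Reasoning

ι-*-E-suc-suc : ∀ n → ι (suc (suc n)) * E (suc (suc n)) ≡ ι (suc n) * E (suc n) + E n
ι-*-E-suc-suc n = begin
  ι (suc (suc n)) * (E (suc n) + - s * inv! (suc (suc n)))
    ≡⟨ pull (ι (suc (suc n))) (E (suc n)) s (inv! (suc (suc n))) ⟩
  ι (suc (suc n)) * E (suc n) - s * (ι (suc (suc n)) * inv! (suc (suc n)))
    ≡⟨ cong₂ (λ x y → x * E (suc n) - s * y) (ι-suc (suc n)) (ι-suc-*-inv!-suc (suc n)) ⟩
  (1ℚ + ι (suc n)) * (E n + s * inv! (suc n)) - s * inv! (suc n)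
    ≡⟨ cancel (ι (suc n)) (E n) s (inv! (suc n)) ⟩
  ι (suc n) * E (suc n) + E n ∎
  where
  open ≡-Reasoning
  s = sgn (suc n)
  pull : ∀ a e s v → a * (e + - s * v) ≡ a * e - s * (a * v)
  pull = solve-∀ ℚ-ring
  cancel : ∀ a e s v → (1ℚ + a) * (e + s * v) - s * v ≡ a * (e + s * v) + e
  cancel = solve-∀ ℚ-ring

derivative-E : ∀ n → derivative E n + E n ≡ partialSums E n
derivative-E zero    = refl
derivative-E (suc n) = begin
  ι (suc (suc n)) * E (suc (suc n)) + E (suc n)   ≡⟨ cong (_+ E (suc n)) (ι-*-E-suc-suc n) ⟩
  (derivative E n + E n) + E (suc n)              ≡⟨ cong (_+ E (suc n)) (derivative-E n) ⟩
  partialSums E (suc n)                           ∎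
  where open ≡-Reasoning

derivative-partialSums^-E : ∀ k n → derivative (partialSums^ k E) n + partialSums^ k E n
                                    ≡ ι (suc k) * partialSums^ (suc k) E n
derivative-partialSums^-E zero    n = trans (derivative-E n) (sym (*-identityˡ (partialSums E n)))
derivative-partialSums^-E (suc k) n = begin
  derivative (partialSums W) n + partialSums W n
    ≡⟨ cong (_+ partialSums W n) (derivative-partialSums W n) ⟩
  (partialSums (derivative W) n + partialSums W′ n) + partialSums W n
    ≡⟨ +-swapʳ (partialSums (derivative W) n) (partialSums W′ n) (partialSums W n) ⟩
  (partialSums (derivative W) n + partialSums W n) + partialSums W′ n
    ≡⟨ cong (_+ partialSums W′ n) (sumTo-distrib-+ n (derivative W) W) ⟨
  sumTo n (λ j → derivative W j + W j) + partialSums W′ n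
    ≡⟨ cong (_+ partialSums W′ n) (sumTo-cong n (derivative-partialSums^-E k)) ⟩
  sumTo n (λ j → ι (suc k) * W′ j) + partialSums W′ n
    ≡⟨ cong (_+ partialSums W′ n) (*-distribˡ-sumTo n (ι (suc k)) W′) ⟨
  ι (suc k) * partialSums W′ n + partialSums W′ n
    ≡⟨ succ (ι (suc k)) (partialSums W′ n) ⟩
  (1ℚ + ι (suc k)) * partialSums W′ n
    ≡⟨ cong (_* partialSums W′ n) (ι-suc (suc k)) ⟨
  ι (suc (suc k)) * partialSums W′ n ∎
  where
  open ≡-Reasoning
  W  = partialSums^ k E
  W′ = partialSums W
  +-swapʳ : ∀ a b c → (a + b) + c ≡ (a + c) + b
  +-swapʳ = solve-∀ ℚ-ring
  succ : ∀ a x → a * x + x ≡ (1ℚ + a) * x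
  succ = solve-∀ ℚ-ring

leibnizCoeff : ℕ → ℕ → ℚ
leibnizCoeff m k = binom (+ m) k * sgn (m ∸ k) * ι (k !)

leibnizCoeff-suc-zero : ∀ m → leibnizCoeff (suc m) 0 ≡ - leibnizCoeff m 0
leibnizCoeff-suc-zero m = neg (sgn m)
  where
  neg : ∀ s → 1ℚ * - s * 1ℚ ≡ - (1ℚ * s * 1ℚ)
  neg = solve-∀ ℚ-ring

leibnizCoeff-vanishes : ∀ m → leibnizCoeff m (suc m) ≡ 0ℚ
leibnizCoeff-vanishes m = begin
  binom (+ m) (suc m) * sgn (m ∸ suc m) * ι (suc m !)
    ≡⟨ cong (λ b → b * sgn (m ∸ suc m) * ι (suc m !)) (binom-vanishes {m} ℕ.≤-refl) ⟩
  0ℚ * sgn (m ∸ suc m) * ι (suc m !)                  ≡⟨ annihilate (sgn (m ∸ suc m)) (ι (suc m !)) ⟩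
  0ℚ                                                  ∎
  where
  open ≡-Reasoning
  annihilate : ∀ s f → 0ℚ * s * f ≡ 0ℚ
  annihilate = solve-∀ ℚ-ring

-- When k ≥ m the sign identity fails because m ∸ k truncates, but then the binomial vanishes.
binom-*-sgn-∸-suc : ∀ m k → binom (+ m) (suc k) * sgn (m ∸ k) ≡ - (binom (+ m) (suc k) * sgn (m ∸ suc k))
binom-*-sgn-∸-suc m k with k ℕ.<? m
... | yes k<m =
  trans (cong (binom (+ m) (suc k) *_) (sgn-∸-suc k<m)) (neg (binom (+ m) (suc k)) (sgn (m ∸ suc k)))
  where
  neg : ∀ b s → b * - s ≡ - (b * s)
  neg = solve-∀ ℚ-ring
... | no k≮m rewrite binom-vanishes (ℕ.≮⇒≥ k≮m) = annihilate (sgn (m ∸ k)) (sgn (m ∸ suc k))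
  where
  annihilate : ∀ s s′ → 0ℚ * s ≡ - (0ℚ * s′)
  annihilate = solve-∀ ℚ-ring

leibnizCoeff-suc-suc : ∀ m k →
  leibnizCoeff (suc m) (suc k) ≡ ι (suc k) * leibnizCoeff m k - leibnizCoeff m (suc k)
leibnizCoeff-suc-suc m k = begin
  binom (+ suc m) (suc k) * s * ι (suc k ℕ.* k !)
    ≡⟨ cong₂ (λ b f → b * s * f) (binom-pascal (+ suc m) k) (ι-* (suc k) (k !)) ⟩
  (B₁ + B₀) * s * (ι (suc k) * ι (k !))
    ≡⟨ expand B₁ B₀ s (ι (suc k)) (ι (k !)) ⟩
  ι (suc k) * (B₀ * s * ι (k !)) + B₁ * s * (ι (suc k) * ι (k !))
    ≡⟨ cong₂ (λ x f → ι (suc k) * (B₀ * s * ι (k !)) + x * f)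
             (binom-*-sgn-∸-suc m k) (sym (ι-* (suc k) (k !))) ⟩
  ι (suc k) * leibnizCoeff m k + - (B₁ * sgn (m ∸ suc k)) * ι (suc k ℕ.* k !)
    ≡⟨ neg (ι (suc k) * leibnizCoeff m k) (B₁ * sgn (m ∸ suc k)) (ι (suc k ℕ.* k !)) ⟩
  ι (suc k) * leibnizCoeff m k - leibnizCoeff m (suc k) ∎
  where
  open ≡-Reasoning
  s  = sgn (m ∸ k)
  B₁ = binom (+ m) (suc k)
  B₀ = binom (+ m) k
  expand : ∀ b₁ b₀ s a f → (b₁ + b₀) * s * (a * f) ≡ a * (b₀ * s * f) + b₁ * s * (a * f)
  expand = solve-∀ ℚ-ring
  neg : ∀ x y f → x + - y * f ≡ x - y * f
  neg = solve-∀ ℚ-ring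

leibnizExpansion : ℕ → ℕ → ℚ
leibnizExpansion m n = sumTo m (λ k → leibnizCoeff m k * partialSums^ k E n)

leibnizExpansion-extend : ∀ m n →
  sumTo (suc m) (λ k → leibnizCoeff m k * partialSums^ k E n) ≡ leibnizExpansion m n
leibnizExpansion-extend m n = begin
  leibnizExpansion m n + leibnizCoeff m (suc m) * partialSums^ (suc m) E n
    ≡⟨ cong (λ c → leibnizExpansion m n + c * partialSums^ (suc m) E n) (leibnizCoeff-vanishes m) ⟩
  leibnizExpansion m n + 0ℚ * partialSums^ (suc m) E n
    ≡⟨ cong (_+_ (leibnizExpansion m n)) (*-zeroˡ (partialSums^ (suc m) E n)) ⟩
  leibnizExpansion m n + 0ℚ
    ≡⟨ +-identityʳ (leibnizExpansion m n) ⟩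
  leibnizExpansion m n ∎
  where open ≡-Reasoning

raisedLeibnizExpansion : ℕ → ℕ → ℚ
raisedLeibnizExpansion m n = sumTo m (λ k → leibnizCoeff m k * (ι (suc k) * partialSums^ (suc k) E n))

leibnizExpansion-suc : ∀ m n → leibnizExpansion (suc m) n ≡ raisedLeibnizExpansion m n - leibnizExpansion m n
leibnizExpansion-suc m n = begin
  sumTo (suc m) (λ k → leibnizCoeff (suc m) k * W k)
    ≡⟨ sumTo-suc-head m (λ k → leibnizCoeff (suc m) k * W k) ⟩
  leibnizCoeff (suc m) 0 * W 0 + sumTo m (λ k → leibnizCoeff (suc m) (suc k) * W (suc k))
    ≡⟨ cong₂ _+_ (cong (_* W 0) (leibnizCoeff-suc-zero m)) (sumTo-cong m step) ⟩
  - c 0 * W 0 + sumTo m (λ k → c k * (ι (suc k) * W (suc k)) - c (suc k) * W (suc k))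
    ≡⟨ cong (_+_ (- c 0 * W 0)) (sumTo-distrib-minus m _ _) ⟩
  - c 0 * W 0 + (raisedLeibnizExpansion m n - sumTo m (λ k → c (suc k) * W (suc k)))
    ≡⟨ regroup (c 0) (W 0) (raisedLeibnizExpansion m n) _ ⟩
  raisedLeibnizExpansion m n - (c 0 * W 0 + sumTo m (λ k → c (suc k) * W (suc k)))
    ≡⟨ cong (_-_ (raisedLeibnizExpansion m n)) (sumTo-suc-head m (λ k → c k * W k)) ⟨
  raisedLeibnizExpansion m n - sumTo (suc m) (λ k → c k * W k)
    ≡⟨ cong (_-_ (raisedLeibnizExpansion m n)) (leibnizExpansion-extend m n) ⟩
  raisedLeibnizExpansion m n - leibnizExpansion m n ∎
  where
  open ≡-Reasoning
  c = leibnizCoeff m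
  W = λ k → partialSums^ k E n
  step : ∀ k → leibnizCoeff (suc m) (suc k) * W (suc k) ≡ c k * (ι (suc k) * W (suc k)) - c (suc k) * W (suc k)
  step k = trans (cong (_* W (suc k)) (leibnizCoeff-suc-suc m k))
                 (distrib (c k) (ι (suc k)) (c (suc k)) (W (suc k)))
    where
    distrib : ∀ x a y w → (a * x - y) * w ≡ x * (a * w) - y * w
    distrib = solve-∀ ℚ-ring
  regroup : ∀ x w r t → - x * w + (r - t) ≡ r - (x * w + t)
  regroup = solve-∀ ℚ-ring

ι-*-leibnizExpansion-suc : ∀ m n → ι (suc n) * leibnizExpansion m (suc n)
                                   ≡ raisedLeibnizExpansion m n - leibnizExpansion m n
ι-*-leibnizExpansion-suc m n = begin
  ι (suc n) * leibnizExpansion m (suc n)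
    ≡⟨ *-distribˡ-sumTo m (ι (suc n)) _ ⟩
  sumTo m (λ k → ι (suc n) * (c k * partialSums^ k E (suc n)))
    ≡⟨ sumTo-cong m step ⟩
  sumTo m (λ k → c k * (ι (suc k) * partialSums^ (suc k) E n) - c k * partialSums^ k E n)
    ≡⟨ sumTo-distrib-minus m _ _ ⟩
  raisedLeibnizExpansion m n - leibnizExpansion m n ∎
  where
  open ≡-Reasoning
  c = leibnizCoeff m
  step : ∀ k → ι (suc n) * (c k * partialSums^ k E (suc n))
               ≡ c k * (ι (suc k) * partialSums^ (suc k) E n) - c k * partialSums^ k E n
  step k = trans (split (ι (suc n)) (c k) (partialSums^ k E (suc n)) (partialSums^ k E n))
                 (cong (λ x → c k * x - c k * partialSums^ k E n) (derivative-partialSums^-E k n))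
    where
    split : ∀ a c w′ w → a * (c * w′) ≡ c * (a * w′ + w) - c * w
    split = solve-∀ ℚ-ring

leibnizExpansion≡inv!*D : ∀ m n → leibnizExpansion m n ≡ inv! n * D (m ℕ.+ n)
leibnizExpansion≡inv!*D zero    n = trans (*-identityˡ (E n)) (sym (inv!-*-D n))
leibnizExpansion≡inv!*D (suc m) n = begin
  leibnizExpansion (suc m) n
    ≡⟨ leibnizExpansion-suc m n ⟩
  raisedLeibnizExpansion m n - leibnizExpansion m n
    ≡⟨ ι-*-leibnizExpansion-suc m n ⟨
  ι (suc n) * leibnizExpansion m (suc n)
    ≡⟨ cong (ι (suc n) *_) (leibnizExpansion≡inv!*D m (suc n)) ⟩
  ι (suc n) * (inv! (suc n) * D (m ℕ.+ suc n))
    ≡⟨ *-assoc (ι (suc n)) (inv! (suc n)) (D (m ℕ.+ suc n)) ⟨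
  (ι (suc n) * inv! (suc n)) * D (m ℕ.+ suc n)
    ≡⟨ cong₂ _*_ (ι-suc-*-inv!-suc n) (cong D (ℕ.+-suc m n)) ⟩
  inv! n * D (suc m ℕ.+ n) ∎
  where open ≡-Reasoning

theorem2p1 : (m n : ℕ) →
    inv! n ℚ.* D (m ℕ.+ n)
      ≡ sumTo n (λ l → sumTo m (λ k →
          binom ((+ (k ℕ.+ (n ∸ l))) ℤ.- (+ 1)) (n ∸ l)
            ℚ.* binom (+ m) k
            ℚ.* sgn (m ∸ k)
            ℚ.* ι (k !) ℚ.* inv! l
            ℚ.* D l))
theorem2p1 m n = begin
  inv! n * D (m ℕ.+ n)
    ≡⟨ leibnizExpansion≡inv!*D m n ⟨
  sumTo m (λ k → leibnizCoeff m k * partialSums^ k E n)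
    ≡⟨ sumTo-cong m (λ k → cong (leibnizCoeff m k *_) (partialSums^-convolution k E n)) ⟩
  sumTo m (λ k → leibnizCoeff m k * (multichoose k ⋆ E) n)
    ≡⟨ sumTo-cong m (λ k → *-distribˡ-sumTo n (leibnizCoeff m k) _) ⟩
  sumTo m (λ k → sumTo n (λ l → leibnizCoeff m k * (multichoose k (n ∸ l) * E l)))
    ≡⟨ sumTo-comm m n _ ⟩
  sumTo n (λ l → sumTo m (λ k → leibnizCoeff m k * (multichoose k (n ∸ l) * E l)))
    ≡⟨ sumTo-cong n (λ l → sumTo-cong m (λ k → term k l)) ⟩
  _ ∎
  where
  open ≡-Reasoning
  rearrange : ∀ b s f c v d → b * s * f * (c * (v * d)) ≡ c * b * s * f * v * d
  rearrange = solve-∀ ℚ-ring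
  term : ∀ k l → leibnizCoeff m k * (multichoose k (n ∸ l) * E l)
                 ≡ multichoose k (n ∸ l) * binom (+ m) k * sgn (m ∸ k) * ι (k !) * inv! l * D l
  term k l = trans (cong (λ e → leibnizCoeff m k * (multichoose k (n ∸ l) * e)) (sym (inv!-*-D l)))
                   (rearrange (binom (+ m) k) (sgn (m ∸ k)) (ι (k !)) (multichoose k (n ∸ l)) (inv! l) (D l))
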